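{- As formal power series in $q$, $$\sum_{n\geq 0}G_n(x_1,x_2;y_1,y_2)q^n=\frac{1+(y_2-x_2)q-\sqrt{1-2(x_2+y_2)q+((x_2+y_2)^2-4x_1y_1)q^2}}{2q},$$ where the square root is the power series with constant term $1$.
   Context: A plane tree is an unlabeled rooted tree in which the children of every vertex are linearly ordered from left to right; $\mathcal{P}_n$ is the set of plane trees with $n$ edges. A leaf is a vertex with no children, an interior vertex one with at least one child. A leaf is an old leaf if it is the leftmost child of its parent (this includes a leaf that is the only child of its parent), and a young leaf otherwise. For $T\in\mathcal P_n$, $\mathrm{oleaf}(T)$ and $\mathrm{yleaf}(T)$ are the numbers of old and young leaves, $\mathrm{oint}(T)$ is the number of interior vertices that are parents of old leaves, and $\mathrm{yint}(T)$ is the number of interior vertices that are not parents of old leaves. For $n\ge1$, $G_n(x_1,x_2;y_1,y_2)=\sum_{T\in\mathcal P_n}x_1^{\mathrm{oleaf}(T)}x_2^{\mathrm{yleaf}(T)}y_1^{\mathrm{oint}(T)}y_2^{\mathrm{yint}(T)}$, and $G_0(x_1,x_2;y_1,y_2)=y_2$. -}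

module Defs where

open import Data.Nat using (ℕ; zero; suc; _∸_) renaming (_+_ to _+ℕ_)
open import Data.Bool using (Bool; true; false; if_then_else_)
open import Data.List using (List; []; _∷_; [_]; length; map; concatMap; upTo)
open import Algebra.Bundles using (CommutativeRing)

-- Plane trees: a vertex together with the ordered list of its subtrees
-- (children listed from left to right).

data PTree : Set where
  node : List PTree → PTree

isLeaf : PTree → Bool
isLeaf (node [])      = true
isLeaf (node (_ ∷ _)) = false

mutual
  stat : (List PTree → ℕ) → PTree → ℕ
  stat loc (node ts) = loc ts +ℕ statF loc ts

  statF : (List PTree → ℕ) → List PTree → ℕ
  statF loc []       = 0
  statF loc (t ∷ ts) = stat loc t +ℕ statF loc ts

edges : PTree → ℕ
edges = stat length

countLeaves : List PTree → ℕ
countLeaves []       = 0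
countLeaves (t ∷ ts) = (if isLeaf t then 1 else 0) +ℕ countLeaves ts

-- old leaf: leftmost child of its parent, and a leaf
oleafLoc : List PTree → ℕ
oleafLoc []      = 0
oleafLoc (c ∷ _) = if isLeaf c then 1 else 0

-- young leaf: a leaf child that is not the leftmost child
yleafLoc : List PTree → ℕ
yleafLoc []       = 0
yleafLoc (_ ∷ cs) = countLeaves cs

-- interior vertex that is a parent of an old leaf (i.e. its leftmost child is a leaf)
ointLoc : List PTree → ℕ
ointLoc []      = 0
ointLoc (c ∷ _) = if isLeaf c then 1 else 0

-- interior vertex that is not a parent of an old leaf
yintLoc : List PTree → ℕ
yintLoc []      = 0
yintLoc (c ∷ _) = if isLeaf c then 0 else 1

oleaf yleaf oint yint : PTree → ℕ
oleaf = stat oleafLoc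
yleaf = stat yleafLoc
oint  = stat ointLoc
yint  = stat yintLoc

-- Enumeration of plane trees with n edges.
-- forestsFuel fuel n : all ordered forests (lists of plane trees) whose
-- trees, each hung below a common root, use n edges in total
-- (a tree t contributes 1 + edges t).  Correct whenever fuel ≥ n.
-- For n+1 edges: the first tree has k edges (k = 0..n, contributing k+1),
-- the remaining forest uses n ∸ k edges.

forestsFuel : ℕ → ℕ → List (List PTree)
forestsFuel _          zero    = [ [] ]
forestsFuel zero       (suc n) = []
forestsFuel (suc fuel) (suc n) =
  concatMap (λ k → concatMap (λ f → map (λ g → node f ∷ g) (forestsFuel fuel (n ∸ k)))
                             (forestsFuel fuel k))
            (upTo (suc n))

-- 𝒫 n : the list of all plane trees with n edges (each exactly once)
𝒫 : ℕ → List PTree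
𝒫 n = map node (forestsFuel n n)

-- The polynomial G_n(x₁,x₂;y₁,y₂) is evaluated at arbitrary ring
-- elements x₁ x₂ y₁ y₂ (taking R = ℤ[x₁,x₂,y₁,y₂] recovers the polynomial identity).

module Series {c ℓ} (R : CommutativeRing c ℓ) where
  open CommutativeRing R

  PS : Set c
  PS = ℕ → Carrier

  _^'_ : Carrier → ℕ → Carrier
  x ^' zero  = 1#
  x ^' suc n = x * (x ^' n)

  sumL : List Carrier → Carrier
  sumL []       = 0#
  sumL (a ∷ as) = a + sumL as

  _⊕_ : PS → PS → PS
  (f ⊕ g) n = f n + g n

  ⊖_ : PS → PS
  (⊖ f) n = - (f n)

  ι : Carrier → PS
  ι a zero    = a
  ι a (suc n) = 0#

  q·_ : PS → PS
  (q· f) zero    = 0#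
  (q· f) (suc n) = f n

  _⊛_ : PS → PS → PS
  (f ⊛ g) n = sumL (map (λ i → f i * g (n ∸ i)) (upTo (suc n)))

  _≋_ : PS → PS → Set ℓ
  f ≋ g = ∀ n → f n ≈ g n

  two four : Carrier
  two  = 1# + 1#
  four = two + two

  module _ (x₁ x₂ y₁ y₂ : Carrier) where

    weight : PTree → Carrier
    weight T = (x₁ ^' oleaf T) * ((x₂ ^' yleaf T) * ((y₁ ^' oint T) * (y₂ ^' yint T)))

    -- G_n(x₁,x₂;y₁,y₂), with the convention G_0 = y₂
    G : ℕ → Carrier
    G zero    = y₂
    G (suc n) = sumL (map weight (𝒫 (suc n)))

    GF : PS
    GF = G

    D : PS
    D = ι 1# ⊕ ((q· ι (- (two * (x₂ + y₂))))
             ⊕ (q· (q· ι (((x₂ + y₂) * (x₂ + y₂)) - (four * (x₁ * y₁))))))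

    -- The series 1 + (y₂ − x₂) q − 2q · GF.  The theorem says exactly that this is
    -- √D, i.e. it has constant term 1 and squares to D.
    S : PS
    S = ι 1# ⊕ ((q· ι (y₂ - x₂)) ⊕ (⊖ (q· (λ n → two * GF n))))

{-# OPTIONS --safe #-}
module Submission where

-- A plane tree with at least one edge consists of its root, a leftmost subtree t and a forest h of
-- further subtrees.  Whether the root is a parent of an old leaf depends only on whether t is a leaf,
-- and every tree of h that is a leaf is a young leaf.  Let N be the series of trees with at least one edge
-- and F the series of forests weighted as such sibling forests.  Then N = q B F and F = 1 + q E F,
-- where B = x₁y₁ + y₂N and E = x₂ + N.  Eliminating F gives N = q(x₁y₁ + y₂N) + q(x₂ + N)N.  Since
-- G = y₂ + N, the series 1 + (y₂ − x₂)q − 2qG equals 1 − (x₂ + y₂)q − 2qN, and the quadratic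
-- equation says exactly that its square is D.

open import Defs
open import Algebra.Bundles using (CommutativeRing; AbelianGroup)
open import Algebra.Structures using (IsCommutativeRing)
import Algebra.Construct.Pointwise as Pointwise
import Algebra.Consequences.Setoid as Consequences
open import Data.Nat using (ℕ; zero; suc; _∸_; _≤_; s≤s) renaming (_+_ to _+ℕ_)
open import Data.Nat.Properties using (≤-trans; ≤-refl; ≤-pred; m∸n≤m)
open import Data.Product using (_×_; _,_)
open import Data.Bool using (if_then_else_)
open import Data.List using (List; []; _∷_; map; concat; concatMap; upTo; _++_)
open import Data.List.Properties using (map-upTo; map-∘; map-cong-local)
open import Data.List.Relation.Unary.All.Properties using (applyUpTo⁺₁)
open import Function using (_∘_; id)
open import Relation.Binary.PropositionalEquality as ≡ using (_≡_)

module PowerSeries {c ℓ} (R : CommutativeRing c ℓ) where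
  open CommutativeRing R
  open Series R
  open import Algebra.Properties.CommutativeSemigroup +-commutativeSemigroup
    using (interchange; x∙yz≈y∙xz)
  open import Algebra.Properties.Group +-group using (ε⁻¹≈ε)
  open import Relation.Binary.Reasoning.Setoid setoid

  tail : PS → PS
  tail f n = f (suc n)

  0ₚ : PS
  0ₚ _ = 0#

  _·_ : Carrier → PS → PS
  (a · f) n = a * f n

  ⊛-zero : ∀ f g → (f ⊛ g) 0 ≈ f 0 * g 0
  ⊛-zero f g = +-identityʳ (f 0 * g 0)

  ⊛-suc : ∀ f g n → (f ⊛ g) (suc n) ≈ f 0 * g (suc n) + (tail f ⊛ g) n
  ⊛-suc f g n = reflexive (≡.trans (≡.cong sumL (map-upTo term (suc (suc n))))
                                   (≡.cong (f 0 * g (suc n) +_) (≡.cong sumL (≡.sym (map-upTo (λ i → term (suc i)) (suc n))))))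
    where
    term : ℕ → Carrier
    term i = f i * g (suc n ∸ i)

  ⊛-cong : ∀ {f f′ g g′} → f ≋ f′ → g ≋ g′ → (f ⊛ g) ≋ (f′ ⊛ g′)
  ⊛-cong {f} {f′} {g} {g′} f≋f′ g≋g′ zero = begin
    (f ⊛ g) 0    ≈⟨ ⊛-zero f g ⟩
    f 0 * g 0    ≈⟨ *-cong (f≋f′ 0) (g≋g′ 0) ⟩
    f′ 0 * g′ 0  ≈⟨ ⊛-zero f′ g′ ⟨
    (f′ ⊛ g′) 0  ∎
  ⊛-cong {f} {f′} {g} {g′} f≋f′ g≋g′ (suc n) = begin
    (f ⊛ g) (suc n)                          ≈⟨ ⊛-suc f g n ⟩
    f 0 * g (suc n) + (tail f ⊛ g) n         ≈⟨ +-cong (*-cong (f≋f′ 0) (g≋g′ (suc n))) (⊛-cong (λ m → f≋f′ (suc m)) g≋g′ n) ⟩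
    f′ 0 * g′ (suc n) + (tail f′ ⊛ g′) n     ≈⟨ ⊛-suc f′ g′ n ⟨
    (f′ ⊛ g′) (suc n)                        ∎

  ⊛-zeroˡ : ∀ f → (0ₚ ⊛ f) ≋ 0ₚ
  ⊛-zeroˡ f zero    = trans (⊛-zero 0ₚ f) (zeroˡ (f 0))
  ⊛-zeroˡ f (suc n) = begin
    (0ₚ ⊛ f) (suc n)                ≈⟨ ⊛-suc 0ₚ f n ⟩
    0# * f (suc n) + (0ₚ ⊛ f) n     ≈⟨ +-cong (zeroˡ (f (suc n))) (⊛-zeroˡ f n) ⟩
    0# + 0#                         ≈⟨ +-identityˡ 0# ⟩
    0#                              ∎

  ι-⊛ : ∀ a f → (ι a ⊛ f) ≋ (a · f)
  ι-⊛ a f zero    = ⊛-zero (ι a) f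
  ι-⊛ a f (suc n) = begin
    (ι a ⊛ f) (suc n)              ≈⟨ ⊛-suc (ι a) f n ⟩
    a * f (suc n) + (0ₚ ⊛ f) n     ≈⟨ +-congˡ (⊛-zeroˡ f n) ⟩
    a * f (suc n) + 0#             ≈⟨ +-identityʳ _ ⟩
    a * f (suc n)                  ∎

  ⊛-identityˡ : ∀ f → (ι 1# ⊛ f) ≋ f
  ⊛-identityˡ f n = trans (ι-⊛ 1# f n) (*-identityˡ (f n))

  ·-⊛-assoc : ∀ a f g → ((a · f) ⊛ g) ≋ (a · (f ⊛ g))
  ·-⊛-assoc a f g zero = begin
    ((a · f) ⊛ g) 0     ≈⟨ ⊛-zero (a · f) g ⟩
    a * f 0 * g 0       ≈⟨ *-assoc a (f 0) (g 0) ⟩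
    a * (f 0 * g 0)     ≈⟨ *-congˡ (⊛-zero f g) ⟨
    a * (f ⊛ g) 0       ∎
  ·-⊛-assoc a f g (suc n) = begin
    ((a · f) ⊛ g) (suc n)                                ≈⟨ ⊛-suc (a · f) g n ⟩
    a * f 0 * g (suc n) + ((a · tail f) ⊛ g) n           ≈⟨ +-cong (*-assoc a (f 0) (g (suc n))) (·-⊛-assoc a (tail f) g n) ⟩
    a * (f 0 * g (suc n)) + a * (tail f ⊛ g) n           ≈⟨ distribˡ a _ _ ⟨
    a * (f 0 * g (suc n) + (tail f ⊛ g) n)               ≈⟨ *-congˡ (⊛-suc f g n) ⟨
    a * (f ⊛ g) (suc n)                                  ∎

  ⊛-distribʳ : ∀ h f g → ((f ⊕ g) ⊛ h) ≋ ((f ⊛ h) ⊕ (g ⊛ h))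
  ⊛-distribʳ h f g zero = begin
    ((f ⊕ g) ⊛ h) 0              ≈⟨ ⊛-zero (f ⊕ g) h ⟩
    (f 0 + g 0) * h 0            ≈⟨ distribʳ (h 0) (f 0) (g 0) ⟩
    f 0 * h 0 + g 0 * h 0        ≈⟨ +-cong (⊛-zero f h) (⊛-zero g h) ⟨
    (f ⊛ h) 0 + (g ⊛ h) 0        ∎
  ⊛-distribʳ h f g (suc n) = begin
    ((f ⊕ g) ⊛ h) (suc n)
      ≈⟨ ⊛-suc (f ⊕ g) h n ⟩
    (f 0 + g 0) * h (suc n) + ((tail f ⊕ tail g) ⊛ h) n
      ≈⟨ +-cong (distribʳ (h (suc n)) (f 0) (g 0)) (⊛-distribʳ h (tail f) (tail g) n) ⟩
    (f 0 * h (suc n) + g 0 * h (suc n)) + ((tail f ⊛ h) n + (tail g ⊛ h) n)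
      ≈⟨ interchange _ _ _ _ ⟩
    (f 0 * h (suc n) + (tail f ⊛ h) n) + (g 0 * h (suc n) + (tail g ⊛ h) n)
      ≈⟨ +-cong (⊛-suc f h n) (⊛-suc g h n) ⟨
    (f ⊛ h) (suc n) + (g ⊛ h) (suc n)
      ∎

  tail-⊛ : ∀ f g → tail (f ⊛ g) ≋ ((f 0 · tail g) ⊕ (tail f ⊛ g))
  tail-⊛ f g n = ⊛-suc f g n

  ⊛-assoc : ∀ f g h → ((f ⊛ g) ⊛ h) ≋ (f ⊛ (g ⊛ h))
  ⊛-assoc f g h zero = begin
    ((f ⊛ g) ⊛ h) 0        ≈⟨ ⊛-zero (f ⊛ g) h ⟩
    (f ⊛ g) 0 * h 0        ≈⟨ *-congʳ (⊛-zero f g) ⟩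
    f 0 * g 0 * h 0        ≈⟨ *-assoc (f 0) (g 0) (h 0) ⟩
    f 0 * (g 0 * h 0)      ≈⟨ *-congˡ (⊛-zero g h) ⟨
    f 0 * (g ⊛ h) 0        ≈⟨ ⊛-zero f (g ⊛ h) ⟨
    (f ⊛ (g ⊛ h)) 0        ∎
  ⊛-assoc f g h (suc n) = begin
    ((f ⊛ g) ⊛ h) (suc n)
      ≈⟨ ⊛-suc (f ⊛ g) h n ⟩
    (f ⊛ g) 0 * h (suc n) + (tail (f ⊛ g) ⊛ h) n
      ≈⟨ +-cong (*-congʳ (⊛-zero f g)) (⊛-cong {g = h} (tail-⊛ f g) (λ _ → refl) n) ⟩
    f 0 * g 0 * h (suc n) + (((f 0 · tail g) ⊕ (tail f ⊛ g)) ⊛ h) n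
      ≈⟨ +-congˡ (⊛-distribʳ h (f 0 · tail g) (tail f ⊛ g) n) ⟩
    f 0 * g 0 * h (suc n) + (((f 0 · tail g) ⊛ h) n + ((tail f ⊛ g) ⊛ h) n)
      ≈⟨ +-cong (*-assoc (f 0) (g 0) (h (suc n))) (+-cong (·-⊛-assoc (f 0) (tail g) h n) (⊛-assoc (tail f) g h n)) ⟩
    f 0 * (g 0 * h (suc n)) + (f 0 * (tail g ⊛ h) n + (tail f ⊛ (g ⊛ h)) n)
      ≈⟨ +-assoc _ _ _ ⟨
    (f 0 * (g 0 * h (suc n)) + f 0 * (tail g ⊛ h) n) + (tail f ⊛ (g ⊛ h)) n
      ≈⟨ +-congʳ (distribˡ (f 0) _ _) ⟨
    f 0 * (g 0 * h (suc n) + (tail g ⊛ h) n) + (tail f ⊛ (g ⊛ h)) n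
      ≈⟨ +-congʳ (*-congˡ (⊛-suc g h n)) ⟨
    f 0 * (g ⊛ h) (suc n) + (tail f ⊛ (g ⊛ h)) n
      ≈⟨ ⊛-suc f (g ⊛ h) n ⟨
    (f ⊛ (g ⊛ h)) (suc n)
      ∎

  ⊛-comm : ∀ f g → (f ⊛ g) ≋ (g ⊛ f)
  ⊛-comm f g zero = begin
    (f ⊛ g) 0    ≈⟨ ⊛-zero f g ⟩
    f 0 * g 0    ≈⟨ *-comm (f 0) (g 0) ⟩
    g 0 * f 0    ≈⟨ ⊛-zero g f ⟨
    (g ⊛ f) 0    ∎
  ⊛-comm f g (suc zero) = begin
    (f ⊛ g) 1                        ≈⟨ ⊛-suc f g 0 ⟩
    f 0 * g 1 + (tail f ⊛ g) 0       ≈⟨ +-congˡ (⊛-zero (tail f) g) ⟩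
    f 0 * g 1 + f 1 * g 0            ≈⟨ +-cong (*-comm (f 0) (g 1)) (*-comm (f 1) (g 0)) ⟩
    g 1 * f 0 + g 0 * f 1            ≈⟨ +-comm _ _ ⟩
    g 0 * f 1 + g 1 * f 0            ≈⟨ +-congˡ (⊛-zero (tail g) f) ⟨
    g 0 * f 1 + (tail g ⊛ f) 0       ≈⟨ ⊛-suc g f 0 ⟨
    (g ⊛ f) 1                        ∎
  ⊛-comm f g (suc (suc n)) = begin
    (f ⊛ g) (suc (suc n))
      ≈⟨ ⊛-suc f g (suc n) ⟩
    f 0 * g (suc (suc n)) + (tail f ⊛ g) (suc n)
      ≈⟨ +-congˡ (trans (⊛-comm (tail f) g (suc n)) (⊛-suc g (tail f) n)) ⟩
    f 0 * g (suc (suc n)) + (g 0 * f (suc (suc n)) + (tail g ⊛ tail f) n)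
      ≈⟨ x∙yz≈y∙xz _ _ _ ⟩
    g 0 * f (suc (suc n)) + (f 0 * g (suc (suc n)) + (tail g ⊛ tail f) n)
      ≈⟨ +-congˡ (+-congˡ (⊛-comm (tail g) (tail f) n)) ⟩
    g 0 * f (suc (suc n)) + (f 0 * g (suc (suc n)) + (tail f ⊛ tail g) n)
      ≈⟨ +-congˡ (trans (⊛-comm (tail g) f (suc n)) (⊛-suc f (tail g) n)) ⟨
    g 0 * f (suc (suc n)) + (tail g ⊛ f) (suc n)
      ≈⟨ ⊛-suc g f (suc n) ⟨
    (g ⊛ f) (suc (suc n))
      ∎

  +-abelianGroupₚ : AbelianGroup c ℓ
  +-abelianGroupₚ = Pointwise.abelianGroup ℕ +-abelianGroup

  open Consequences (AbelianGroup.setoid +-abelianGroupₚ)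
    using (comm∧idˡ⇒id; comm∧distrʳ⇒distr)

  isCommutativeRingₚ : IsCommutativeRing _≋_ _⊕_ _⊛_ ⊖_ 0ₚ (ι 1#)
  isCommutativeRingₚ = record
    { isRing = record
      { +-isAbelianGroup = AbelianGroup.isAbelianGroup +-abelianGroupₚ
      ; *-cong           = ⊛-cong
      ; *-assoc          = ⊛-assoc
      ; *-identity       = comm∧idˡ⇒id ⊛-comm ⊛-identityˡ
      ; distrib          = comm∧distrʳ⇒distr (AbelianGroup.∙-cong +-abelianGroupₚ) ⊛-comm ⊛-distribʳ
      }
    ; *-comm = ⊛-comm
    }

  commutativeRingₚ : CommutativeRing c ℓ
  commutativeRingₚ = record { isCommutativeRing = isCommutativeRingₚ }

  X : PS
  X = q· ι 1#

  q·≋X⊛ : ∀ f → (q· f) ≋ (X ⊛ f)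
  q·≋X⊛ f zero    = sym (trans (⊛-zero X f) (zeroˡ (f 0)))
  q·≋X⊛ f (suc n) = sym (begin
    (X ⊛ f) (suc n)                   ≈⟨ ⊛-suc X f n ⟩
    0# * f (suc n) + (ι 1# ⊛ f) n     ≈⟨ +-cong (zeroˡ (f (suc n))) (⊛-identityˡ f n) ⟩
    0# + f n                          ≈⟨ +-identityˡ (f n) ⟩
    f n                               ∎)

  ι-+ : ∀ a b → ι (a + b) ≋ (ι a ⊕ ι b)
  ι-+ a b zero    = refl
  ι-+ a b (suc n) = sym (+-identityʳ 0#)

  ι-* : ∀ a b → ι (a * b) ≋ (ι a ⊛ ι b)
  ι-* a b n = sym (trans (ι-⊛ a (ι b) n) (ι-*-pointwise n))
    where
    ι-*-pointwise : ∀ n → a * ι b n ≈ ι (a * b) n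
    ι-*-pointwise zero    = refl
    ι-*-pointwise (suc n) = zeroʳ a

  ι-neg : ∀ a → ι (- a) ≋ (⊖ ι a)
  ι-neg a zero    = refl
  ι-neg a (suc n) = sym ε⁻¹≈ε

module Discriminant {c ℓ} (R : CommutativeRing c ℓ) where
  open CommutativeRing R
  open Series R using (two; four)
  open import Algebra.Properties.Group +-group using (∙-cancelʳ)
  open import Algebra.Solver.Ring.NaturalCoefficients.Default commutativeSemiring
  open import Relation.Binary.Reasoning.Setoid setoid

  N≈XB+XEN : ∀ X B E F N → N ≈ X * (B * F) → F ≈ 1# + X * (E * F) → N ≈ X * B + X * (E * N)
  N≈XB+XEN X B E F N N≈XBF F≈1+XEF = begin
    N                                ≈⟨ N≈XBF ⟩
    X * (B * F)                      ≈⟨ *-congˡ (*-congˡ F≈1+XEF) ⟩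
    X * (B * (1# + X * (E * F)))     ≈⟨ solve 4 (λ X B E F → X :* (B :* (con 1 :+ X :* (E :* F))) := X :* B :+ X :* (E :* (X :* (B :* F)))) refl X B E F ⟩
    X * B + X * (E * (X * (B * F)))  ≈⟨ +-congˡ (*-congˡ (*-congˡ N≈XBF)) ⟨
    X * B + X * (E * N)              ∎

  -- The solver has natural coefficients, so S and D are handled as u − t and v − w with
  -- subtraction-free u, t, v, w, and S² = D reduces to u² + t² + w = v + 2tu.
  private module _ (X x y p N : Carrier) where

    S D t u w v : Carrier
    S = 1# + (X * (y - x) + - (X * (two * (y + N))))
    D = 1# + (X * - (two * (x + y)) + X * (X * ((x + y) * (x + y) - four * p)))
    t = X * x + X * (two * (y + N))
    u = 1# + X * y
    w = X * (two * (x + y)) + X * (X * (four * p))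
    v = 1# + X * (X * ((x + y) * (x + y)))

    S+t≈u : S + t ≈ u
    S+t≈u = begin
      S + t
        ≈⟨ solve 6 (λ X x y x⁻ m m⁻ → (con 1 :+ (X :* (y :+ x⁻) :+ m⁻)) :+ (X :* x :+ m)
                                     := (con 1 :+ X :* y) :+ (X :* (x :+ x⁻) :+ (m⁻ :+ m)))
                   refl X x y (- x) (X * (two * (y + N))) (- (X * (two * (y + N)))) ⟩
      u + (X * (x - x) + (- m + m))
        ≈⟨ +-congˡ (+-cong (trans (*-congˡ (-‿inverseʳ x)) (zeroʳ X)) (-‿inverseˡ m)) ⟩
      u + (0# + 0#)
        ≈⟨ trans (+-congˡ (+-identityʳ 0#)) (+-identityʳ u) ⟩
      u ∎
      where m = X * (two * (y + N))

    D+w≈v : D + w ≈ v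
    D+w≈v = begin
      D + w
        ≈⟨ solve 6 (λ X s² a a⁻ b b⁻ → (con 1 :+ (X :* a⁻ :+ X :* (X :* (s² :+ b⁻)))) :+ (X :* a :+ X :* (X :* b))
                                      := (con 1 :+ X :* (X :* s²)) :+ (X :* (a⁻ :+ a) :+ X :* (X :* (b⁻ :+ b))))
                   refl X ((x + y) * (x + y)) a (- a) b (- b) ⟩
      v + (X * (- a + a) + X * (X * (- b + b)))
        ≈⟨ +-congˡ (+-cong (annihilate X a) (*-congˡ (annihilate X b))) ⟩
      v + (0# + X * 0#)
        ≈⟨ +-congˡ (trans (+-identityˡ _) (zeroʳ X)) ⟩
      v + 0#
        ≈⟨ +-identityʳ v ⟩
      v ∎
      where
      a = two * (x + y)
      b = four * p
      annihilate : ∀ X a → X * (- a + a) ≈ 0#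
      annihilate X a = trans (*-congˡ (-‿inverseˡ a)) (zeroʳ X)

    module _ (quadratic : N ≈ X * (p + y * N) + X * ((x + N) * N)) where

      u²+t²+w≈v+2tu : u * u + t * t + w ≈ v + two * (t * u)
      u²+t²+w≈v+2tu = ∙-cancelʳ (four * (X * N)) _ _ (begin
        (u * u + t * t + w) + four * (X * N)
          ≈⟨ solve 5 (λ X x y p N →
               let two = con 2
                   t = X :* x :+ X :* (two :* (y :+ N))
                   u = con 1 :+ X :* y
               in (u :* u :+ t :* t :+ (X :* (two :* (x :+ y)) :+ X :* (X :* ((two :+ two) :* p))))
                    :+ (two :+ two) :* (X :* N)
                  := (con 1 :+ X :* (X :* ((x :+ y) :* (x :+ y))) :+ two :* (t :* u))
                    :+ (two :+ two) :* (X :* (X :* (p :+ y :* N) :+ X :* ((x :+ N) :* N))))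
               refl X x y p N ⟩
        (v + two * (t * u)) + four * (X * (X * (p + y * N) + X * ((x + N) * N)))
          ≈⟨ +-congˡ (*-congˡ (*-congˡ quadratic)) ⟨
        (v + two * (t * u)) + four * (X * N) ∎)

      S²+w≈v : S * S + w ≈ v
      S²+w≈v = ∙-cancelʳ (two * (t * u)) _ _ (begin
        (S * S + w) + two * (t * u)        ≈⟨ +-congˡ (*-congˡ (*-congˡ S+t≈u)) ⟨
        (S * S + w) + two * (t * (S + t))
          ≈⟨ solve 3 (λ S t w → (S :* S :+ w) :+ con 2 :* (t :* (S :+ t)) := (S :+ t) :* (S :+ t) :+ t :* t :+ w) refl S t w ⟩
        (S + t) * (S + t) + t * t + w      ≈⟨ +-congʳ (+-congʳ (*-cong S+t≈u S+t≈u)) ⟩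
        u * u + t * t + w                  ≈⟨ u²+t²+w≈v+2tu ⟩
        v + two * (t * u)                  ∎)

      S²≈D : S * S ≈ D
      S²≈D = ∙-cancelʳ w _ _ (trans S²+w≈v (sym D+w≈v))

  square≈discriminant : ∀ X x y p N → N ≈ X * (p + y * N) + X * ((x + N) * N) →
    (1# + (X * (y - x) + - (X * (two * (y + N))))) * (1# + (X * (y - x) + - (X * (two * (y + N)))))
      ≈ 1# + (X * - (two * (x + y)) + X * (X * ((x + y) * (x + y) - four * p)))
  square≈discriminant = S²≈D

module ListSum {c ℓ} (R : CommutativeRing c ℓ) where
  open CommutativeRing R
  open Series R using (sumL)

  private variable A B : Set

  sumOver : (A → Carrier) → List A → Carrier
  sumOver f xs = sumL (map f xs)

  sumOver-++ : ∀ (f : A → Carrier) xs ys → sumOver f (xs ++ ys) ≈ sumOver f xs + sumOver f ys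
  sumOver-++ f []       ys = sym (+-identityˡ _)
  sumOver-++ f (x ∷ xs) ys = trans (+-congˡ (sumOver-++ f xs ys)) (sym (+-assoc _ _ _))

  sumOver-cong : ∀ {f g : A → Carrier} → (∀ x → f x ≈ g x) → ∀ xs → sumOver f xs ≈ sumOver g xs
  sumOver-cong f≈g []       = refl
  sumOver-cong f≈g (x ∷ xs) = +-cong (f≈g x) (sumOver-cong f≈g xs)

  sumOver-*ˡ : ∀ a (f : A → Carrier) xs → sumOver (λ x → a * f x) xs ≈ a * sumOver f xs
  sumOver-*ˡ a f []       = sym (zeroʳ a)
  sumOver-*ˡ a f (x ∷ xs) = trans (+-congˡ (sumOver-*ˡ a f xs)) (sym (distribˡ a _ _))

  sumOver-*ʳ : ∀ a (f : A → Carrier) xs → sumOver (λ x → f x * a) xs ≈ sumOver f xs * a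
  sumOver-*ʳ a f []       = sym (zeroˡ a)
  sumOver-*ʳ a f (x ∷ xs) = trans (+-congˡ (sumOver-*ʳ a f xs)) (sym (distribʳ a _ _))

  sumOver-map : ∀ (f : B → Carrier) (g : A → B) xs → sumOver f (map g xs) ≡ sumOver (f ∘ g) xs
  sumOver-map f g xs = ≡.cong sumL (≡.sym (map-∘ xs))

  sumOver-concatMap : ∀ (f : B → Carrier) (g : A → List B) xs →
                      sumOver f (concatMap g xs) ≈ sumOver (sumOver f ∘ g) xs
  sumOver-concatMap f g []       = refl
  sumOver-concatMap f g (x ∷ xs) = trans (sumOver-++ f (g x) (concatMap g xs)) (+-congˡ (sumOver-concatMap f g xs))

module PlaneTreeWeights {c ℓ} (R : CommutativeRing c ℓ) (x₁ x₂ y₁ y₂ : CommutativeRing.Carrier R) where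
  open CommutativeRing R
  open Series R using (_^'_)
  open import Algebra.Properties.CommutativeSemigroup *-commutativeSemigroup using (interchange)
  open import Algebra.Solver.Ring.NaturalCoefficients.Default commutativeSemiring
  open import Relation.Binary.Reasoning.Setoid setoid

  weight : PTree → Carrier
  weight = Series.weight R x₁ x₂ y₁ y₂

  ^'-+ : ∀ z m n → z ^' (m +ℕ n) ≈ z ^' m * z ^' n
  ^'-+ z zero    n = sym (*-identityˡ (z ^' n))
  ^'-+ z (suc m) n = trans (*-congˡ (^'-+ z m n)) (sym (*-assoc z _ _))

  monomial : ℕ → ℕ → ℕ → ℕ → Carrier
  monomial a b c d = (x₁ ^' a) * ((x₂ ^' b) * ((y₁ ^' c) * (y₂ ^' d)))

  monomial-+ : ∀ a b c d a′ b′ c′ d′ →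
               monomial (a +ℕ a′) (b +ℕ b′) (c +ℕ c′) (d +ℕ d′) ≈ monomial a b c d * monomial a′ b′ c′ d′
  monomial-+ a b c d a′ b′ c′ d′ = begin
    monomial (a +ℕ a′) (b +ℕ b′) (c +ℕ c′) (d +ℕ d′)
      ≈⟨ *-cong (^'-+ x₁ a a′) (*-cong (^'-+ x₂ b b′) (*-cong (^'-+ y₁ c c′) (^'-+ y₂ d d′))) ⟩
    (A * A′) * ((B * B′) * ((C * C′) * (D * D′)))
      ≈⟨ *-congˡ (*-congˡ (interchange C C′ D D′)) ⟩
    (A * A′) * ((B * B′) * ((C * D) * (C′ * D′)))
      ≈⟨ *-congˡ (interchange B B′ (C * D) (C′ * D′)) ⟩
    (A * A′) * ((B * (C * D)) * (B′ * (C′ * D′)))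
      ≈⟨ interchange A A′ _ _ ⟩
    monomial a b c d * monomial a′ b′ c′ d′
      ∎
    where
    A = x₁ ^' a; A′ = x₁ ^' a′; B = x₂ ^' b; B′ = x₂ ^' b′
    C = y₁ ^' c; C′ = y₁ ^' c′; D = y₂ ^' d; D′ = y₂ ^' d′

  monomial-0 : monomial 0 0 0 0 ≈ 1#
  monomial-0 = trans (*-identityˡ _) (trans (*-identityˡ _) (*-identityˡ _))

  forestWeight : List PTree → Carrier
  forestWeight ts = monomial (statF oleafLoc ts) (statF yleafLoc ts) (statF ointLoc ts) (statF yintLoc ts)

  forestWeight-∷ : ∀ t ts → forestWeight (t ∷ ts) ≈ weight t * forestWeight ts
  forestWeight-∷ t ts = monomial-+ (oleaf t) (yleaf t) (oint t) (yint t) _ _ _ _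

  weight-node : ∀ ts → weight (node ts) ≈ monomial (oleafLoc ts) (yleafLoc ts) (ointLoc ts) (yintLoc ts) * forestWeight ts
  weight-node ts = monomial-+ (oleafLoc ts) (yleafLoc ts) (ointLoc ts) (yintLoc ts) _ _ _ _

  -- The weight of ts as the non-leftmost subtrees of a vertex: each leaf among them is young.
  siblingsWeight : List PTree → Carrier
  siblingsWeight ts = x₂ ^' countLeaves ts * forestWeight ts

  siblingsWeight-[] : siblingsWeight [] ≈ 1#
  siblingsWeight-[] = trans (*-identityˡ _) monomial-0

  rootFactor leafFactor : PTree → Carrier
  rootFactor (node [])      = x₁ * y₁
  rootFactor (node (_ ∷ _)) = y₂
  leafFactor (node [])      = x₂
  leafFactor (node (_ ∷ _)) = 1#

  rootMonomial : ∀ t ts → monomial (oleafLoc (t ∷ ts)) (yleafLoc (t ∷ ts)) (ointLoc (t ∷ ts)) (yintLoc (t ∷ ts))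
                          ≈ rootFactor t * x₂ ^' countLeaves ts
  rootMonomial (node [])      ts = solve 3 (λ a b P → (a :* con 1) :* (P :* ((b :* con 1) :* con 1)) := (a :* b) :* P)
                                         refl x₁ y₁ (x₂ ^' countLeaves ts)
  rootMonomial (node (_ ∷ _)) ts = solve 2 (λ d P → con 1 :* (P :* (con 1 :* (d :* con 1))) := d :* P)
                                         refl y₂ (x₂ ^' countLeaves ts)

  leafPower : ∀ t → x₂ ^' (if isLeaf t then 1 else 0) ≈ leafFactor t
  leafPower (node [])      = *-identityʳ x₂
  leafPower (node (_ ∷ _)) = refl

  weight-node-∷ : ∀ t ts → weight (node (t ∷ ts)) ≈ (rootFactor t * weight t) * siblingsWeight ts
  weight-node-∷ t ts = begin
    weight (node (t ∷ ts))
      ≈⟨ weight-node (t ∷ ts) ⟩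
    monomial (oleafLoc (t ∷ ts)) (yleafLoc (t ∷ ts)) (ointLoc (t ∷ ts)) (yintLoc (t ∷ ts)) * forestWeight (t ∷ ts)
      ≈⟨ *-cong (rootMonomial t ts) (forestWeight-∷ t ts) ⟩
    (rootFactor t * x₂ ^' countLeaves ts) * (weight t * forestWeight ts)
      ≈⟨ interchange _ _ _ _ ⟩
    (rootFactor t * weight t) * siblingsWeight ts
      ∎

  siblingsWeight-∷ : ∀ t ts → siblingsWeight (t ∷ ts) ≈ (leafFactor t * weight t) * siblingsWeight ts
  siblingsWeight-∷ t ts = begin
    siblingsWeight (t ∷ ts)
      ≈⟨ *-cong (^'-+ x₂ (if isLeaf t then 1 else 0) (countLeaves ts)) (forestWeight-∷ t ts) ⟩
    (x₂ ^' (if isLeaf t then 1 else 0) * x₂ ^' countLeaves ts) * (weight t * forestWeight ts)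
      ≈⟨ *-congʳ (*-congʳ (leafPower t)) ⟩
    (leafFactor t * x₂ ^' countLeaves ts) * (weight t * forestWeight ts)
      ≈⟨ interchange _ _ _ _ ⟩
    (leafFactor t * weight t) * siblingsWeight ts
      ∎

module Forests where

  -- forestsFuel (suc a) (suc n) reduces to extendForests (forestsFuel a) n.
  extendForests : (ℕ → List (List PTree)) → ℕ → List (List PTree)
  extendForests A n = concatMap (λ k → concatMap (λ f → map (λ g → node f ∷ g) (A (n ∸ k))) (A k)) (upTo (suc n))

  extendForests-cong : ∀ {A B} n → (∀ {k} → k ≤ n → A k ≡ B k) → extendForests A n ≡ extendForests B n
  extendForests-cong n A≡B = ≡.cong concat (map-cong-local (applyUpTo⁺₁ id (suc n) λ {k} k<1+n →
    ≡.cong₂ (λ Ak An∸k → concatMap (λ f → map (λ g → node f ∷ g) An∸k) Ak) (A≡B (≤-pred k<1+n)) (A≡B (m∸n≤m n k))))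

  forestsFuel-irrelevant : ∀ {a b m} → m ≤ a → m ≤ b → forestsFuel a m ≡ forestsFuel b m
  forestsFuel-irrelevant {m = zero}              _         _         = ≡.refl
  forestsFuel-irrelevant {suc a} {suc b} {suc n} (s≤s n≤a) (s≤s n≤b) =
    extendForests-cong n λ k≤n → forestsFuel-irrelevant (≤-trans k≤n n≤a) (≤-trans k≤n n≤b)

  forests : ℕ → List (List PTree)
  forests n = forestsFuel n n

  forests-suc : ∀ n → forests (suc n) ≡ extendForests forests n
  forests-suc n = extendForests-cong n λ k≤n → forestsFuel-irrelevant k≤n ≤-refl

module ForestSums {c ℓ} (R : CommutativeRing c ℓ) where
  open CommutativeRing R
  open Series R using (PS; _⊛_)
  open ListSum R
  open Forests
  open import Relation.Binary.Reasoning.Setoid setoid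

  sumOver-extendForests : ∀ (φ : List PTree → Carrier) A n →
    sumOver φ (extendForests A n)
      ≈ sumOver (λ k → sumOver (λ f → sumOver (λ g → φ (node f ∷ g)) (A (n ∸ k))) (A k)) (upTo (suc n))
  sumOver-extendForests φ A n = begin
    sumOver φ (extendForests A n)
      ≈⟨ sumOver-concatMap φ (λ k → concatMap (λ f → map (λ g → node f ∷ g) (A (n ∸ k))) (A k)) (upTo (suc n)) ⟩
    sumOver (λ k → sumOver φ (concatMap (λ f → map (λ g → node f ∷ g) (A (n ∸ k))) (A k))) (upTo (suc n))
      ≈⟨ sumOver-cong (λ k → sumOver-concatMap φ _ (A k)) (upTo (suc n)) ⟩
    sumOver (λ k → sumOver (λ f → sumOver φ (map (λ g → node f ∷ g) (A (n ∸ k)))) (A k)) (upTo (suc n))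
      ≈⟨ sumOver-cong (λ k → sumOver-cong (λ f → reflexive (sumOver-map φ _ (A (n ∸ k)))) (A k)) (upTo (suc n)) ⟩
    sumOver (λ k → sumOver (λ f → sumOver (λ g → φ (node f ∷ g)) (A (n ∸ k))) (A k)) (upTo (suc n))
      ∎

  sumOver-extendForests-cong : ∀ {φ ψ : List PTree → Carrier} A n → (∀ t ts → φ (t ∷ ts) ≈ ψ (t ∷ ts)) →
                               sumOver φ (extendForests A n) ≈ sumOver ψ (extendForests A n)
  sumOver-extendForests-cong {φ} {ψ} A n φ≈ψ = begin
    sumOver φ (extendForests A n)
      ≈⟨ sumOver-extendForests φ A n ⟩
    sumOver (λ k → sumOver (λ f → sumOver (λ g → φ (node f ∷ g)) (A (n ∸ k))) (A k)) (upTo (suc n))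
      ≈⟨ sumOver-cong (λ k → sumOver-cong (λ f → sumOver-cong (λ g → φ≈ψ (node f) g) (A (n ∸ k))) (A k)) (upTo (suc n)) ⟩
    sumOver (λ k → sumOver (λ f → sumOver (λ g → ψ (node f ∷ g)) (A (n ∸ k))) (A k)) (upTo (suc n))
      ≈⟨ sumOver-extendForests ψ A n ⟨
    sumOver ψ (extendForests A n)
      ∎

  forestSeries : (List PTree → Carrier) → PS
  forestSeries φ n = sumOver φ (forests n)

  forestSeries-suc : ∀ {φ α β : List PTree → Carrier} → (∀ f g → φ (node f ∷ g) ≈ α f * β g) →
                     ∀ n → forestSeries φ (suc n) ≈ (forestSeries α ⊛ forestSeries β) n
  forestSeries-suc {φ} {α} {β} φ≈αβ n = begin
    sumOver φ (forests (suc n))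
      ≡⟨ ≡.cong (sumOver φ) (forests-suc n) ⟩
    sumOver φ (extendForests forests n)
      ≈⟨ sumOver-extendForests φ forests n ⟩
    sumOver (λ k → sumOver (λ f → sumOver (λ g → φ (node f ∷ g)) (forests (n ∸ k))) (forests k)) (upTo (suc n))
      ≈⟨ sumOver-cong (λ k → sumOver-cong (λ f → factor f (forests (n ∸ k))) (forests k)) (upTo (suc n)) ⟩
    sumOver (λ k → sumOver (λ f → α f * forestSeries β (n ∸ k)) (forests k)) (upTo (suc n))
      ≈⟨ sumOver-cong (λ k → sumOver-*ʳ _ α (forests k)) (upTo (suc n)) ⟩
    (forestSeries α ⊛ forestSeries β) n
      ∎
    where
    factor : ∀ f gs → sumOver (λ g → φ (node f ∷ g)) gs ≈ α f * sumOver β gs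
    factor f gs = trans (sumOver-cong (φ≈αβ f) gs) (sumOver-*ˡ (α f) β gs)

module PlaneTreeSeries {c ℓ} (R : CommutativeRing c ℓ) (x₁ x₂ y₁ y₂ : CommutativeRing.Carrier R) where
  open CommutativeRing R
  open Series R using (PS; ι; q·_; _⊕_; _⊛_; _≋_)
  open PowerSeries R using (_·_)
  open ListSum R
  open Forests
  open ForestSums R
  open PlaneTreeWeights R x₁ x₂ y₁ y₂
  open import Relation.Binary.Reasoning.Setoid setoid

  G : ℕ → Carrier
  G = Series.G R x₁ x₂ y₁ y₂

  N : PS
  N zero    = 0#
  N (suc n) = G (suc n)

  G≋y₂+N : G ≋ (ι y₂ ⊕ N)
  G≋y₂+N zero    = sym (+-identityʳ y₂)
  G≋y₂+N (suc n) = sym (+-identityˡ (G (suc n)))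

  treeSeries : (PTree → Carrier) → PS
  treeSeries φ = forestSeries (φ ∘ node)

  N-suc : ∀ n → N (suc n) ≡ treeSeries weight (suc n)
  N-suc n = sumOver-map weight node (forests (suc n))

  B E F : PS
  B = treeSeries (λ t → rootFactor t * weight t)
  E = treeSeries (λ t → leafFactor t * weight t)
  F = forestSeries siblingsWeight

  N≋q·[B⊛F] : N ≋ (q· (B ⊛ F))
  N≋q·[B⊛F] zero    = refl
  N≋q·[B⊛F] (suc n) = trans (reflexive (N-suc n)) (forestSeries-suc (λ f → weight-node-∷ (node f)) n)

  F≋1+q·[E⊛F] : F ≋ (ι 1# ⊕ (q· (E ⊛ F)))
  F≋1+q·[E⊛F] zero    = +-congʳ siblingsWeight-[]
  F≋1+q·[E⊛F] (suc n) = trans (forestSeries-suc (λ f → siblingsWeight-∷ (node f)) n) (sym (+-identityˡ _))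

  B≋x₁y₁+y₂N : B ≋ (ι (x₁ * y₁) ⊕ (y₂ · N))
  B≋x₁y₁+y₂N zero    = +-cong (trans (*-congˡ monomial-0) (*-identityʳ _)) (sym (zeroʳ y₂))
  B≋x₁y₁+y₂N (suc n) = begin
    B (suc n)                                                  ≈⟨ sumOver-extendForests-cong (forestsFuel n) n (λ _ _ → refl) ⟩
    sumOver (λ f → y₂ * weight (node f)) (forests (suc n))     ≈⟨ sumOver-*ˡ y₂ (weight ∘ node) (forests (suc n)) ⟩
    y₂ * treeSeries weight (suc n)                             ≈⟨ *-congˡ (reflexive (N-suc n)) ⟨
    y₂ * N (suc n)                                             ≈⟨ +-identityˡ _ ⟨
    0# + y₂ * N (suc n)                                        ∎

  E≋x₂+N : E ≋ (ι x₂ ⊕ N)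
  E≋x₂+N zero    = +-congʳ (trans (*-congˡ monomial-0) (*-identityʳ x₂))
  E≋x₂+N (suc n) = begin
    E (suc n)                         ≈⟨ sumOver-extendForests-cong (forestsFuel n) n (λ t ts → *-identityˡ _) ⟩
    treeSeries weight (suc n)         ≈⟨ reflexive (N-suc n) ⟨
    N (suc n)                         ≈⟨ +-identityˡ _ ⟨
    0# + N (suc n)                    ∎

module GeneratingFunction {c ℓ} (R : CommutativeRing c ℓ) (x₁ x₂ y₁ y₂ : CommutativeRing.Carrier R) where
  open PowerSeries R
  open PlaneTreeSeries R x₁ x₂ y₁ y₂
  open Series R using (PS; ι; q·_; S; D)
  open CommutativeRing commutativeRingₚ
  open Series commutativeRingₚ using (two; four)
  open Discriminant commutativeRingₚ
  open import Relation.Binary.Reasoning.Setoid setoid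
  private module Base = CommutativeRing R

  x y p : PS
  x = ι x₂
  y = ι y₂
  p = ι (x₁ Base.* y₁)

  N-quadratic : N ≈ X * (p + y * N) + X * ((x + N) * N)
  N-quadratic = begin
    N                      ≈⟨ N≈XB+XEN X B E F N (trans N≋q·[B⊛F] (q·≋X⊛ _)) (trans F≋1+q·[E⊛F] (+-congˡ (q·≋X⊛ _))) ⟩
    X * B + X * (E * N)    ≈⟨ +-cong (*-congˡ (trans B≋x₁y₁+y₂N (+-congˡ (sym (ι-⊛ y₂ N))))) (*-congˡ (*-congʳ E≋x₂+N)) ⟩
    X * (p + y * N) + X * ((x + N) * N) ∎

  ι-two : ι (Series.two R) ≈ two
  ι-two = ι-+ Base.1# Base.1#

  ι-four : ι (Series.four R) ≈ four
  ι-four = trans (ι-+ _ _) (+-cong ι-two ι-two)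

  S≈polynomial : S x₁ x₂ y₁ y₂ ≈ 1# + (X * (y - x) + - (X * (two * (y + N))))
  S≈polynomial = +-congˡ (+-cong (trans (q·≋X⊛ _) (*-congˡ (trans (ι-+ _ _) (+-congˡ (ι-neg x₂)))))
                       (-‿cong (trans (q·≋X⊛ _) (*-congˡ (trans (sym (ι-⊛ _ G)) (*-cong ι-two G≋y₂+N))))))

  D≈polynomial : D x₁ x₂ y₁ y₂ ≈ 1# + (X * - (two * (x + y)) + X * (X * ((x + y) * (x + y) - four * p)))
  D≈polynomial = +-congˡ (+-cong (trans (q·≋X⊛ _) (*-congˡ q-coefficient)) (trans (q·≋X⊛ _) (*-congˡ (trans (q·≋X⊛ _) (*-congˡ q²-coefficient)))))
    where
    q-coefficient : ι (Base.- (Series.two R Base.* (x₂ Base.+ y₂))) ≈ - (two * (x + y))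
    q-coefficient = trans (ι-neg _) (-‿cong (trans (ι-* _ _) (*-cong ι-two (ι-+ x₂ y₂))))
    q²-coefficient : ι ((x₂ Base.+ y₂) Base.* (x₂ Base.+ y₂) Base.- Series.four R Base.* (x₁ Base.* y₁))
                ≈ (x + y) * (x + y) - four * p
    q²-coefficient = trans (ι-+ _ _) (+-cong (trans (ι-* _ _) (*-cong (ι-+ x₂ y₂) (ι-+ x₂ y₂)))
                                        (trans (ι-neg _) (-‿cong (trans (ι-* _ _) (*-congʳ ι-four)))))

  S²≈D : S x₁ x₂ y₁ y₂ * S x₁ x₂ y₁ y₂ ≈ D x₁ x₂ y₁ y₂
  S²≈D = begin
    S x₁ x₂ y₁ y₂ * S x₁ x₂ y₁ y₂  ≈⟨ *-cong S≈polynomial S≈polynomial ⟩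
    _                              ≈⟨ square≈discriminant X x y p N N-quadratic ⟩
    _                              ≈⟨ D≈polynomial ⟨
    D x₁ x₂ y₁ y₂                  ∎

  S-constant : S x₁ x₂ y₁ y₂ 0 Base.≈ Base.1#
  S-constant = Base.trans (Base.+-congˡ (Base.trans (Base.+-identityˡ _) ε⁻¹≈ε)) (Base.+-identityʳ Base.1#)
    where open import Algebra.Properties.Group Base.+-group using (ε⁻¹≈ε)

theorem1p11 : ∀ {c ℓ} (R : CommutativeRing c ℓ) (x₁ x₂ y₁ y₂ : CommutativeRing.Carrier R) →
    CommutativeRing._≈_ R (Series.S R x₁ x₂ y₁ y₂ 0) (CommutativeRing.1# R)
      × Series._≋_ R (Series._⊛_ R (Series.S R x₁ x₂ y₁ y₂) (Series.S R x₁ x₂ y₁ y₂)) (Series.D R x₁ x₂ y₁ y₂)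
theorem1p11 R x₁ x₂ y₁ y₂ = S-constant , S²≈D
  where open GeneratingFunction R x₁ x₂ y₁ y₂
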